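{- Let $p>0$ and $V\in M_p^+$. Then $\pi(V)\in M_{p-1}^+$.
   Context: $M$ is the set of integer vectors $(v_1,\dots,v_{J+1})$ with $J\ge1$ odd, $v_i\ge1$ for $1\le i\le J$, $v_{J+1}\ge0$. For $V\in M$ the alternating parameters are $\rho_0=0$ and, for $0\le i\le J$, $\rho_{i+1}=\rho_i+v_{i+1}$ if $i$ is even, $\rho_{i+1}=\rho_i-v_{i+1}$ if $i$ is odd. For $q\ge0$, $M_q^+$ is the set of $V\in M$ for which there is an odd $t$ with $1\le t\le J$, $\rho_i>0$ for $1\le i\le t$, and $\rho_t\ge q+1$. (For $p>0$ every $V\in M_p^+$ has $v_1>1$, so $\pi(V)$ below is defined.) Contraction: for $V=(v_1,\dots,v_{J+1})\in M$ with $v_1>1$, let $\tau(0)=0$, $\tau(r)=(v_1-1)+\cdots+(v_r-1)$ for $1\le r\le J+1$. For $0\le r\le J$ let $next(r)=r+2t+1$ where $t\ge0$ is maximal such that $r+2t\le J$ and $v_{r+2i}=1$ for $1\le i\le t$. Let $r_0=0$, $r_{j+1}=next(r_j)$, until $r_{I+1}=J+1$. Then $\pi(V)=(\tau(r_1)-\tau(r_0),\dots,\tau(r_I)-\tau(r_{I-1}),\tau(J+1)-\tau(r_I)+1)$. -}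

module Defs where

open import Data.Nat as ℕ using (ℕ; zero; suc; _∸_; _≤?_)
open import Data.Integer as ℤ using (ℤ; +_; _+_; _-_; _>_; _≥_; _≟_)
open import Data.List using (List; []; _∷_; length)
open import Data.Product using (Σ; _×_; ∃-syntax)
open import Data.Bool using (if_then_else_)
open import Relation.Nullary.Decidable using (⌊_⌋; _×-dec_)
open import Relation.Binary.PropositionalEquality using (_≡_)
open import Data.Nat.DivMod using (_%_)

Odd : ℕ → Set
Odd n = n % 2 ≡ 1


-- Vectors V = (v_1,...,v_{J+1}) are lists of integers.
-- 1-indexed access: at V i = v_i (and 0 outside the range 1..length V).
at : List ℤ → ℕ → ℤ
at []       _             = + 0
at (x ∷ xs) zero          = + 0
at (x ∷ xs) (suc zero)    = x
at (x ∷ xs) (suc (suc i)) = at xs (suc i)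

lenJ : List ℤ → ℕ
lenJ V = length V ∸ 1

InM : List ℤ → Set
InM V = Odd (lenJ V) × (1 ℕ.≤ length V)
      × ((i : ℕ) → 1 ℕ.≤ i → i ℕ.≤ lenJ V → at V i ≥ + 1)
      × (at V (suc (lenJ V)) ≥ + 0)

ρ : List ℤ → ℕ → ℤ
ρ V zero    = + 0
ρ V (suc i) = if ⌊ (i % 2) ℕ.≟ 0 ⌋ then ρ V i + at V (suc i) else ρ V i - at V (suc i)

InM⁺ : ℕ → List ℤ → Set
InM⁺ q V = InM V × ∃[ t ] (Odd t × 1 ℕ.≤ t × t ℕ.≤ lenJ V
         × ((i : ℕ) → 1 ℕ.≤ i → i ℕ.≤ t → ρ V i > + 0)
         × ρ V t ≥ + suc q)

τ : List ℤ → ℕ → ℤ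
τ V zero    = + 0
τ V (suc r) = τ V r + (at V (suc r) - + 1)

-- maximal t with r+2t ≤ J and v_{r+2i} = 1 for 1 ≤ i ≤ t (search from k, with fuel)
maxT : List ℤ → ℕ → ℕ → ℕ → ℕ
maxT V r zero       k = k
maxT V r (suc fuel) k =
  if ⌊ (r ℕ.+ 2 ℕ.* suc k ≤? lenJ V) ×-dec (at V (r ℕ.+ 2 ℕ.* suc k) ≟ + 1) ⌋
  then maxT V r fuel (suc k) else k

next : List ℤ → ℕ → ℕ
next V r = r ℕ.+ 2 ℕ.* maxT V r (lenJ V) 0 ℕ.+ 1

-- r_1, r_2, ..., r_{I+1} = J+1 (starting from r, while r ≤ J)
rSeq : List ℤ → ℕ → ℕ → List ℕ
rSeq V zero       r = []
rSeq V (suc fuel) r =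
  if ⌊ r ≤? lenJ V ⌋ then next V r ∷ rSeq V fuel (next V r) else []

diffs : List ℤ → ℕ → List ℕ → List ℤ
diffs V prev []           = []
diffs V prev (x ∷ [])     = (τ V x - τ V prev) + + 1 ∷ []
diffs V prev (x ∷ y ∷ xs) = (τ V x - τ V prev) ∷ diffs V x (y ∷ xs)

π : List ℤ → List ℤ
π V = diffs V 0 (rSeq V (suc (lenJ V)) 0)

-- The cuts 0 = r_0 < r_1 < ... < r_{I+1} = J + 1 of the contraction have the parity of their
-- index.  Between consecutive cuts the entries v = 1 at even offsets contribute nothing to τ and
-- their ±1 to ρ cancels, so at an odd offset from r_j, ρ has moved from ρ(r_j) by the accumulated
-- τ-increment plus one; consequently ρ of π(V) at i is ρ(r_i) for even i and ρ(r_i) - 1 for odd i.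
-- If t witnesses V ∈ M_p^+ and r_j < t ≤ r_{j+1}, then either t is at an odd offset from an even
-- cut and ρ(r_{j+1}) ≥ ρ(t), or at an even offset from an odd cut and ρ(r_j) > ρ(t).  Either way
-- the odd index j + 1, resp. j, witnesses π(V) ∈ M_{p-1}^+, positivity before it coming from the
-- positivity of ρ before t.

module Submission where

open import Defs
open import Data.Nat using (ℕ; _<_; _∸_)
open import Data.List using (List)
open import Data.Integer using (ℤ)

open import Data.Bool using (Bool; true; false; not; if_then_else_)
open import Data.Bool.Properties using (not-involutive; not-injective; not-¬)
open import Data.Empty using (⊥-elim)
open import Data.Integer as ℤ using (+_; +≤+; +<+)
import Data.Integer.Properties as ℤₚ
import Data.Integer.Tactic.RingSolver as ℤ-Ring
open import Data.List using (_∷_; length; applyUpTo)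
open import Data.Nat using (zero; suc; _+_; _*_; _≤_; z≤n; s≤s; _≤?_; _≟_; _≤′_; ≤′-refl; ≤′-step)
open import Data.Nat.DivMod using (_%_; [m+n]%n≡m%n; m%n<n)
import Data.Nat.Properties as ℕₚ
import Data.Nat.Tactic.RingSolver as ℕ-Ring
open import Data.Product using (_×_; _,_; proj₁; proj₂; ∃-syntax)
open import Data.Sum as Sum using (_⊎_; inj₁; inj₂)
open import Function using (_∘_)
open import Relation.Nullary using (yes; no)
open import Relation.Nullary.Decidable using (⌊_⌋; _×-dec_)
open import Relation.Binary.PropositionalEquality
  using (_≡_; _≢_; refl; sym; trans; cong; cong₂; subst; subst₂; module ≡-Reasoning)

+-2*-suc : ∀ r i → r + 2 * suc i ≡ suc (suc (r + 2 * i))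
+-2*-suc = ℕ-Ring.solve-∀

isEven : ℕ → Bool
isEven i = ⌊ i % 2 ≟ 0 ⌋

isEven-2+ : ∀ i → isEven (suc (suc i)) ≡ isEven i
isEven-2+ i = cong (λ k → ⌊ k ≟ 0 ⌋) (trans (cong (_% 2) (ℕₚ.+-comm 2 i)) ([m+n]%n≡m%n i 2))

isEven-suc : ∀ i → isEven (suc i) ≡ not (isEven i)
isEven-suc zero    = refl
isEven-suc (suc i) =
  trans (isEven-2+ i) (sym (trans (cong not (isEven-suc i)) (not-involutive (isEven i))))

isEven-+-2* : ∀ n i → isEven (n + 2 * i) ≡ isEven n
isEven-+-2* n zero    = cong isEven (ℕₚ.+-identityʳ n)
isEven-+-2* n (suc i) =
  trans (cong isEven (+-2*-suc n i)) (trans (isEven-2+ (n + 2 * i)) (isEven-+-2* n i))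

odd⇒¬isEven : ∀ t → Odd t → isEven t ≡ false
odd⇒¬isEven t t%2≡1 = cong (λ k → ⌊ k ≟ 0 ⌋) t%2≡1

¬isEven⇒odd : ∀ t → isEven t ≡ false → Odd t
¬isEven⇒odd t e with t % 2 | m%n<n t 2
¬isEven⇒odd t () | zero        | _
¬isEven⇒odd t e  | suc zero    | _            = refl
¬isEven⇒odd t e  | suc (suc _) | s≤s (s≤s ())

-- ρ V (suc i) unfolds definitionally to addOrSub (isEven i) (ρ V i) (at V (suc i)).
addOrSub : Bool → ℤ → ℤ → ℤ
addOrSub b x y = if b then x ℤ.+ y else x ℤ.- y

indicator : Bool → ℤ
indicator true  = + 1
indicator false = + 0

-- A step of size 1 against direction b followed by a step of size w along it.
addOrSub-detour : ∀ b {c d y v} x D w → c ≡ not b → d ≡ b → y ≡ addOrSub b x D → v ≡ + 1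
                → addOrSub d (addOrSub c y v) w ≡ addOrSub b x (D ℤ.+ (w ℤ.- + 1))
addOrSub-detour true  x D w refl refl refl refl = identity x D w
  where
  identity : ∀ x D w → x ℤ.+ D ℤ.- + 1 ℤ.+ w ≡ x ℤ.+ (D ℤ.+ (w ℤ.- + 1))
  identity = ℤ-Ring.solve-∀
addOrSub-detour false x D w refl refl refl refl = identity x D w
  where
  identity : ∀ x D w → x ℤ.- D ℤ.+ + 1 ℤ.- w ≡ x ℤ.- (D ℤ.+ (w ℤ.- + 1))
  identity = ℤ-Ring.solve-∀

addOrSub-shift : ∀ b x d → addOrSub b (x ℤ.- indicator (not b)) d
                         ≡ addOrSub b x (d ℤ.+ + 1) ℤ.- indicator b
addOrSub-shift true  x d = identity x d
  where
  identity : ∀ x d → x ℤ.- + 0 ℤ.+ d ≡ x ℤ.+ (d ℤ.+ + 1) ℤ.- + 1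
  identity = ℤ-Ring.solve-∀
addOrSub-shift false x d = identity x d
  where
  identity : ∀ x d → x ℤ.- + 1 ℤ.- d ≡ x ℤ.- (d ℤ.+ + 1) ℤ.- + 0
  identity = ℤ-Ring.solve-∀

crossing : (f : ℕ → ℕ) → (∀ i → f i < f (suc i)) → ∀ {x} → f 0 < x →
           ∃[ j ] ((∀ i → i ≤ j → f i < x) × x ≤ f (suc j))
crossing f f-inc {x} f0<x = search x f f-inc f0<x (ℕₚ.m≤n+m x (f 0))
  where
  search : ∀ n (g : ℕ → ℕ) → (∀ i → g i < g (suc i)) → g 0 < x → x ≤ g 0 + n →
           ∃[ j ] ((∀ i → i ≤ j → g i < x) × x ≤ g (suc j))
  search zero    g _     g0<x x≤g0+0 =
    ⊥-elim (ℕₚ.<⇒≱ g0<x (subst (x ≤_) (ℕₚ.+-identityʳ (g 0)) x≤g0+0))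
  search (suc n) g g-inc g0<x x≤g0+1+n with x ≤? g 1
  ... | yes x≤g1 = 0 , (λ { zero _ → g0<x }) , x≤g1
  ... | no  x≰g1 with search n (g ∘ suc) (g-inc ∘ suc) (ℕₚ.≰⇒> x≰g1) x≤g1+n
    where
    x≤g1+n : x ≤ g 1 + n
    x≤g1+n = ℕₚ.≤-trans x≤g0+1+n
               (subst (_≤ g 1 + n) (sym (ℕₚ.+-suc (g 0) n)) (ℕₚ.+-monoˡ-≤ n (g-inc 0)))
  ... | j , below , above = suc j , (λ { zero _ → g0<x ; (suc i) (s≤s i≤j) → below i i≤j }) , above

halving : ∀ m d → 1 ≤ d → d ≤ suc (2 * m) →
          (∃[ i ] (i ≤ m × d ≡ suc (2 * i))) ⊎ (∃[ i ] (i < m × d ≡ suc (suc (2 * i))))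
halving m       zero                ()  _
halving m       (suc zero)          _   _ = inj₁ (0 , z≤n , refl)
halving zero    (suc (suc _))       _   (s≤s ())
halving (suc m) (suc (suc zero))    _   _ = inj₂ (0 , s≤s z≤n , refl)
halving (suc m) (suc (suc (suc d))) _   d+3≤ with halving m (suc d) (s≤s z≤n) d+1≤
  where
  d+1≤ : suc d ≤ suc (2 * m)
  d+1≤ = ℕₚ.≤-pred (ℕₚ.≤-pred (subst (suc (suc (suc d)) ≤_) (cong suc (+-2*-suc 0 m)) d+3≤))
... | inj₁ (i , i≤m , d+1≡) =
  inj₁ (suc i , s≤s i≤m , trans (cong (suc ∘ suc) d+1≡) (cong suc (sym (+-2*-suc 0 i))))
... | inj₂ (i , i<m , d+1≡) =
  inj₂ (suc i , s≤s i<m , trans (cong (suc ∘ suc) d+1≡) (cong (suc ∘ suc) (sym (+-2*-suc 0 i))))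

position-in-run : ∀ {r m t} → r < t → t ≤ suc (r + 2 * m) →
                  (∃[ i ] (i ≤ m × t ≡ suc (r + 2 * i))) ⊎ (∃[ i ] (i < m × t ≡ suc (suc (r + 2 * i))))
position-in-run {r} {m} {t} r<t t≤ =
  Sum.map (λ { (i , i≤m , d≡) → i , i≤m , at-odd i d≡ }) (λ { (i , i<m , d≡) → i , i<m , at-even i d≡ })
          (halving m (t ∸ r) (ℕₚ.m<n⇒0<n∸m r<t) d≤)
  where
  r+d≡t : r + (t ∸ r) ≡ t
  r+d≡t = ℕₚ.m+[n∸m]≡n (ℕₚ.<⇒≤ r<t)
  d≤ : t ∸ r ≤ suc (2 * m)
  d≤ = ℕₚ.+-cancelˡ-≤ r _ _ (subst₂ _≤_ (sym r+d≡t) (sym (ℕₚ.+-suc r (2 * m))) t≤)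
  at-odd : ∀ i → t ∸ r ≡ suc (2 * i) → t ≡ suc (r + 2 * i)
  at-odd i d≡ = trans (sym r+d≡t) (trans (cong (_+_ r) d≡) (ℕₚ.+-suc r (2 * i)))
  at-even : ∀ i → t ∸ r ≡ suc (suc (2 * i)) → t ≡ suc (suc (r + 2 * i))
  at-even i d≡ = trans (sym r+d≡t)
    (trans (cong (_+_ r) d≡) (trans (ℕₚ.+-suc r (suc (2 * i))) (cong suc (ℕₚ.+-suc r (2 * i)))))

module Cuts (V : List ℤ) where

  -- OnesAfter r m: v_{r+2}, v_{r+4}, ..., v_{r+2m} are all 1.  run r is the maximal such m (the
  -- paper's t in next), and cut j is the paper's r_j, so cut (j + 1) = cut j + 2 run (cut j) + 1.
  OnesAfter : ℕ → ℕ → Set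
  OnesAfter r m = ∀ i → i < m → at V (suc (suc (r + 2 * i))) ≡ + 1

  OnesAfter-≤ : ∀ {r i m} → i ≤ m → OnesAfter r m → OnesAfter r i
  OnesAfter-≤ i≤m ones k k<i = ones k (ℕₚ.<-≤-trans k<i i≤m)

  maxT-ones : ∀ r fuel k → OnesAfter r k → OnesAfter r (maxT V r fuel k)
  maxT-ones r zero       k ones = ones
  maxT-ones r (suc fuel) k ones
    with (r + 2 * suc k ≤? lenJ V) ×-dec (at V (r + 2 * suc k) ℤ.≟ + 1)
  ... | no  _         = ones
  ... | yes (_ , v≡1) = maxT-ones r fuel (suc k) extended
    where
    extended : OnesAfter r (suc k)
    extended i (s≤s i≤k) with ℕₚ.m≤n⇒m<n∨m≡n i≤k
    ... | inj₁ i<k  = ones i i<k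
    ... | inj₂ refl = subst (λ p → at V p ≡ + 1) (+-2*-suc r i) v≡1

  maxT-bound : ∀ r fuel k → r + 2 * k ≤ lenJ V → r + 2 * maxT V r fuel k ≤ lenJ V
  maxT-bound r zero       k bound = bound
  maxT-bound r (suc fuel) k bound
    with (r + 2 * suc k ≤? lenJ V) ×-dec (at V (r + 2 * suc k) ℤ.≟ + 1)
  ... | no  _            = bound
  ... | yes (bound′ , _) = maxT-bound r fuel (suc k) bound′

  maxT-maximal : ∀ r fuel k → lenJ V < r + 2 * suc (fuel + k) →
                 r + 2 * suc (maxT V r fuel k) ≤ lenJ V → at V (r + 2 * suc (maxT V r fuel k)) ≢ + 1
  maxT-maximal r zero       k J<end end≤J _ = ℕₚ.<⇒≱ J<end end≤J
  maxT-maximal r (suc fuel) k J<end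
    with (r + 2 * suc k ≤? lenJ V) ×-dec (at V (r + 2 * suc k) ℤ.≟ + 1)
  ... | no  ¬continue = λ end≤J v≡1 → ¬continue (end≤J , v≡1)
  ... | yes _         = maxT-maximal r fuel (suc k)
                          (subst (λ n → lenJ V < r + 2 * suc n) (sym (ℕₚ.+-suc fuel k)) J<end)

  run : ℕ → ℕ
  run r = maxT V r (lenJ V) 0

  run-ones : ∀ r → OnesAfter r (run r)
  run-ones r = maxT-ones r (lenJ V) 0 (λ _ ())

  run-bound : ∀ r → r ≤ lenJ V → r + 2 * run r ≤ lenJ V
  run-bound r r≤J = maxT-bound r (lenJ V) 0 (subst (_≤ lenJ V) (sym (ℕₚ.+-identityʳ r)) r≤J)

  run-maximal : ∀ r → suc (suc (r + 2 * run r)) ≤ lenJ V → at V (suc (suc (r + 2 * run r))) ≢ + 1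
  run-maximal r end≤J =
    subst (λ p → at V p ≢ + 1) (+-2*-suc r (run r))
      (maxT-maximal r (lenJ V) 0 J<end (subst (_≤ lenJ V) (sym (+-2*-suc r (run r))) end≤J))
    where
    J<end : lenJ V < r + 2 * suc (lenJ V + 0)
    J<end = ℕₚ.<-≤-trans (s≤s (ℕₚ.m≤m+n (lenJ V) 0))
              (ℕₚ.≤-trans (ℕₚ.m≤n*m _ 2) (ℕₚ.m≤n+m _ r))

  cut : ℕ → ℕ
  cut zero    = 0
  cut (suc j) = next V (cut j)

  cut-suc : ∀ j → cut (suc j) ≡ suc (cut j + 2 * run (cut j))
  cut-suc j = ℕₚ.+-comm (cut j + 2 * run (cut j)) 1

  cut-strict : ∀ j → cut j < cut (suc j)
  cut-strict j = subst (cut j <_) (sym (cut-suc j)) (s≤s (ℕₚ.m≤m+n (cut j) _))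

  cut-mono : ∀ {i j} → i ≤ j → cut i ≤ cut j
  cut-mono = mono′ ∘ ℕₚ.≤⇒≤′
    where
    mono′ : ∀ {i j} → i ≤′ j → cut i ≤ cut j
    mono′ ≤′-refl            = ℕₚ.≤-refl
    mono′ (≤′-step {j} i≤′j) = ℕₚ.≤-trans (mono′ i≤′j) (ℕₚ.<⇒≤ (cut-strict j))

  cut-cancel-< : ∀ {i j} → cut i < cut j → i < j
  cut-cancel-< cuti<cutj = ℕₚ.≰⇒> (λ j≤i → ℕₚ.<⇒≱ cuti<cutj (cut-mono j≤i))

  ≤-cut : ∀ j → j ≤ cut j
  ≤-cut zero    = z≤n
  ≤-cut (suc j) = ℕₚ.≤-trans (s≤s (≤-cut j)) (cut-strict j)

  cut-bounded : ∀ j → cut j ≤ lenJ V → cut (suc j) ≤ suc (lenJ V)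
  cut-bounded j cut≤J = subst (_≤ suc (lenJ V)) (sym (cut-suc j)) (s≤s (run-bound (cut j) cut≤J))

  isEven-cut : ∀ j → isEven (cut j) ≡ isEven j
  isEven-cut zero    = refl
  isEven-cut (suc j) = begin
    isEven (cut (suc j))                      ≡⟨ cong isEven (cut-suc j) ⟩
    isEven (suc (cut j + 2 * run (cut j)))    ≡⟨ isEven-suc (cut j + 2 * run (cut j)) ⟩
    not (isEven (cut j + 2 * run (cut j)))    ≡⟨ cong not (isEven-+-2* (cut j) (run (cut j))) ⟩
    not (isEven (cut j))                      ≡⟨ cong not (isEven-cut j) ⟩
    not (isEven j)                            ≡⟨ sym (isEven-suc j) ⟩
    isEven (suc j)                            ∎
    where open ≡-Reasoning

  span : ℕ → ℕ → ℤ
  span a b = τ V b ℤ.- τ V a ℤ.+ + 1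

  span-suc : ∀ a → span a (suc a) ≡ at V (suc a)
  span-suc a = identity (τ V a) (at V (suc a))
    where
    identity : ∀ x v → x ℤ.+ (v ℤ.- + 1) ℤ.- x ℤ.+ + 1 ≡ v
    identity = ℤ-Ring.solve-∀

  span-skip-one : ∀ r a → at V (suc (suc a)) ≡ + 1 →
                  span r (suc a) ℤ.+ (at V (suc (suc (suc a))) ℤ.- + 1) ≡ span r (suc (suc (suc a)))
  span-skip-one r a v≡1 =
    trans (identity (τ V (suc a)) (τ V r) (at V (suc (suc (suc a)))))
          (cong (λ v → τ V (suc a) ℤ.+ (v ℤ.- + 1) ℤ.+ (at V (suc (suc (suc a))) ℤ.- + 1)
                         ℤ.- τ V r ℤ.+ + 1) (sym v≡1))
    where
    identity : ∀ x t w → x ℤ.- t ℤ.+ + 1 ℤ.+ (w ℤ.- + 1)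
                       ≡ x ℤ.+ (+ 1 ℤ.- + 1) ℤ.+ (w ℤ.- + 1) ℤ.- t ℤ.+ + 1
    identity = ℤ-Ring.solve-∀

  -- Inside a run the entries v = 1 at even offsets cancel against the 0 they add to τ,
  -- so at odd offsets ρ has moved from ρ r by exactly the span, in the direction of step r + 1.
  ρ-run : ∀ r i → OnesAfter r i →
          ρ V (suc (r + 2 * i)) ≡ addOrSub (isEven r) (ρ V r) (span r (suc (r + 2 * i)))
  ρ-run r zero _ rewrite ℕₚ.+-identityʳ r = cong (addOrSub (isEven r) (ρ V r)) (sym (span-suc r))
  ρ-run r (suc i) ones = begin
    ρ V (suc (r + 2 * suc i))
      ≡⟨ cong (ρ V ∘ suc) (+-2*-suc r i) ⟩
    ρ V (suc (suc (suc a)))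
      ≡⟨ addOrSub-detour (isEven r) (ρ V r) (span r (suc a)) (at V (suc (suc (suc a))))
           (trans (isEven-suc a) (cong not (isEven-+-2* r i)))
           (trans (isEven-2+ a) (isEven-+-2* r i))
           (ρ-run r i (OnesAfter-≤ {r} (ℕₚ.n≤1+n i) ones))
           (ones i ℕₚ.≤-refl) ⟩
    addOrSub (isEven r) (ρ V r) (span r (suc a) ℤ.+ (at V (suc (suc (suc a))) ℤ.- + 1))
      ≡⟨ cong (addOrSub (isEven r) (ρ V r)) (span-skip-one r a (ones i ℕₚ.≤-refl)) ⟩
    addOrSub (isEven r) (ρ V r) (span r (suc (suc (suc a))))
      ≡⟨ cong (λ p → addOrSub (isEven r) (ρ V r) (span r (suc p))) (sym (+-2*-suc r i)) ⟩
    addOrSub (isEven r) (ρ V r) (span r (suc (r + 2 * suc i))) ∎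
    where
    open ≡-Reasoning
    a = r + 2 * i

  ρ-cut : ∀ j → ρ V (cut (suc j)) ≡ addOrSub (isEven j) (ρ V (cut j)) (span (cut j) (cut (suc j)))
  ρ-cut j = begin
    ρ V (cut (suc j))
      ≡⟨ cong (ρ V) (cut-suc j) ⟩
    ρ V (suc (cut j + 2 * run (cut j)))
      ≡⟨ ρ-run (cut j) (run (cut j)) (run-ones (cut j)) ⟩
    addOrSub (isEven (cut j)) (ρ V (cut j)) (span (cut j) (suc (cut j + 2 * run (cut j))))
      ≡⟨ cong₂ (λ b p → addOrSub b (ρ V (cut j)) (span (cut j) p)) (isEven-cut j) (sym (cut-suc j)) ⟩
    addOrSub (isEven j) (ρ V (cut j)) (span (cut j) (cut (suc j))) ∎
    where open ≡-Reasoning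

  rSeq-applyUpTo : (f : ℕ → ℕ) → (∀ k → f (suc k) ≡ next V (f k)) → ∀ n fuel → n ≤ fuel →
                   (∀ k → k < n → f k ≤ lenJ V) → lenJ V < f n →
                   rSeq V fuel (f 0) ≡ applyUpTo (f ∘ suc) n
  rSeq-applyUpTo f f-next zero zero _ _ _ = refl
  rSeq-applyUpTo f f-next zero (suc fuel) _ _ J<f0 with f 0 ≤? lenJ V
  ... | yes f0≤J = ⊥-elim (ℕₚ.<⇒≱ J<f0 f0≤J)
  ... | no  _    = refl
  rSeq-applyUpTo f f-next (suc n) (suc fuel) (s≤s n≤fuel) below J<fn with f 0 ≤? lenJ V
  ... | no  f0≰J = ⊥-elim (f0≰J (below 0 (s≤s z≤n)))
  ... | yes _ rewrite sym (f-next 0) =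
    cong (f 1 ∷_)
      (rSeq-applyUpTo (f ∘ suc) (f-next ∘ suc) n fuel n≤fuel (λ k → below (suc k) ∘ s≤s) J<fn)

  diffs-length : ∀ (f : ℕ → ℕ) n → length (diffs V (f 0) (applyUpTo (f ∘ suc) n)) ≡ n
  diffs-length f zero          = refl
  diffs-length f (suc zero)    = refl
  diffs-length f (suc (suc n)) = cong suc (diffs-length (f ∘ suc) (suc n))

  diffs-at : ∀ (f : ℕ → ℕ) n i → i < n →
             at (diffs V (f 0) (applyUpTo (f ∘ suc) (suc n))) (suc i) ≡ τ V (f (suc i)) ℤ.- τ V (f i)
  diffs-at f (suc n) zero    _           = refl
  diffs-at f (suc n) (suc i) (s≤s i<n) = diffs-at (f ∘ suc) n i i<n

  diffs-last : ∀ (f : ℕ → ℕ) n →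
               at (diffs V (f 0) (applyUpTo (f ∘ suc) (suc n))) (suc n)
               ≡ τ V (f (suc n)) ℤ.- τ V (f n) ℤ.+ + 1
  diffs-last f zero    = refl
  diffs-last f (suc n) = diffs-last (f ∘ suc) n

module PositiveEntries (V : List ℤ) (v≥1 : ∀ i → 1 ≤ i → i ≤ lenJ V → at V i ℤ.≥ + 1) where

  open Cuts V

  τ-mono : ∀ {a b} → a ≤ b → b ≤ lenJ V → τ V a ℤ.≤ τ V b
  τ-mono = mono′ ∘ ℕₚ.≤⇒≤′
    where
    mono′ : ∀ {a b} → a ≤′ b → b ≤ lenJ V → τ V a ℤ.≤ τ V b
    mono′ ≤′-refl            _     = ℤₚ.≤-refl
    mono′ (≤′-step {b} a≤′b) b+1≤J = ℤₚ.≤-trans (mono′ a≤′b (ℕₚ.<⇒≤ b+1≤J))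
      (subst (ℤ._≤ τ V (suc b)) (ℤₚ.+-identityʳ (τ V b))
        (ℤₚ.+-monoʳ-≤ (τ V b) (ℤₚ.i≤j⇒0≤j-i (v≥1 (suc b) (s≤s z≤n) b+1≤J))))

  span-mono : ∀ a {b c} → b ≤ c → c ≤ lenJ V → span a b ℤ.≤ span a c
  span-mono a b≤c c≤J = ℤₚ.+-monoˡ-≤ (+ 1) (ℤₚ.+-monoˡ-≤ (ℤ.- τ V a) (τ-mono b≤c c≤J))

  at-suc≤span : ∀ {a b} → a < b → b ≤ lenJ V → at V (suc a) ℤ.≤ span a b
  at-suc≤span {a} {b} a<b b≤J = subst (ℤ._≤ span a b) (span-suc a) (span-mono a a<b b≤J)

  -- For j > 0 this is the maximality of the run ending at cut j.
  at-suc-cut≥2 : at V 1 ℤ.≥ + 2 → ∀ j → suc (cut j) ≤ lenJ V → at V (suc (cut j)) ℤ.≥ + 2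
  at-suc-cut≥2 v₁≥2 zero    _ = v₁≥2
  at-suc-cut≥2 v₁≥2 (suc j) after≤J = subst (λ p → at V p ℤ.≥ + 2) (sym after≡) (ℤₚ.i<j⇒suc[i]≤j
    (ℤₚ.≤∧≢⇒< (v≥1 _ (s≤s z≤n) end≤J) (λ 1≡v → run-maximal (cut j) end≤J (sym 1≡v))))
    where
    after≡ : suc (cut (suc j)) ≡ suc (suc (cut j + 2 * run (cut j)))
    after≡ = cong suc (cut-suc j)
    end≤J : suc (suc (cut j + 2 * run (cut j))) ≤ lenJ V
    end≤J = subst (_≤ lenJ V) after≡ after≤J

module ContractionShape (V : List ℤ) (v≥1 : ∀ i → 1 ≤ i → i ≤ lenJ V → at V i ℤ.≥ + 1)
                        (odd-J : Odd (lenJ V)) (last≥0 : at V (suc (lenJ V)) ℤ.≥ + 0)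
                        (v₁≥2 : at V 1 ℤ.≥ + 2) where

  open Cuts V
  open PositiveEntries V v≥1

  private
    cuts-end : ∃[ I ] ((∀ i → i ≤ I → cut i < suc (lenJ V)) × suc (lenJ V) ≤ cut (suc I))
    cuts-end = crossing cut cut-strict (s≤s z≤n)

  -- The paper's I: the index of the last cut not exceeding J.
  I : ℕ
  I = proj₁ cuts-end

  cut≤J : ∀ i → i ≤ I → cut i ≤ lenJ V
  cut≤J i i≤I = ℕₚ.≤-pred (proj₁ (proj₂ cuts-end) i i≤I)

  cut-last : cut (suc I) ≡ suc (lenJ V)
  cut-last = ℕₚ.≤-antisym (cut-bounded I (cut≤J I ℕₚ.≤-refl)) (proj₂ (proj₂ cuts-end))

  I-odd : isEven I ≡ false
  I-odd = not-injective (begin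
    not (isEven I)            ≡⟨ sym (isEven-suc I) ⟩
    isEven (suc I)            ≡⟨ sym (isEven-cut (suc I)) ⟩
    isEven (cut (suc I))      ≡⟨ cong isEven cut-last ⟩
    isEven (suc (lenJ V))     ≡⟨ isEven-suc (lenJ V) ⟩
    not (isEven (lenJ V))     ≡⟨ cong not (odd⇒¬isEven (lenJ V) odd-J) ⟩
    true                      ∎)
    where open ≡-Reasoning

  π-unfold : π V ≡ diffs V 0 (applyUpTo (cut ∘ suc) (suc I))
  π-unfold = cong (diffs V 0)
    (rSeq-applyUpTo cut (λ _ → refl) (suc I) (suc (lenJ V))
      (s≤s (ℕₚ.≤-trans (≤-cut I) (cut≤J I ℕₚ.≤-refl)))
      (λ k k<1+I → cut≤J k (ℕₚ.≤-pred k<1+I))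
      (subst (lenJ V <_) (sym cut-last) ℕₚ.≤-refl))

  length-π : length (π V) ≡ suc I
  length-π rewrite π-unfold = diffs-length cut (suc I)

  lenJ-π : lenJ (π V) ≡ I
  lenJ-π = cong (_∸ 1) length-π

  at-π : ∀ i → i < I → at (π V) (suc i) ≡ τ V (cut (suc i)) ℤ.- τ V (cut i)
  at-π i i<I rewrite π-unfold = diffs-at cut I i i<I

  at-π-last : at (π V) (suc I) ≡ τ V (cut (suc I)) ℤ.- τ V (cut I) ℤ.+ + 1
  at-π-last rewrite π-unfold = diffs-last cut I

  at-π≥1 : ∀ i → 1 ≤ i → i ≤ lenJ (π V) → at (π V) i ℤ.≥ + 1
  at-π≥1 (suc i) _ i<lenJ = begin
    + 1                                            ≤⟨ ℤₚ.+-monoˡ-≤ (ℤ.- + 1) v≥2 ⟩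
    at V (suc c) ℤ.- + 1                           ≡⟨ identity (τ V c) (at V (suc c)) ⟩
    τ V (suc c) ℤ.- τ V c                          ≤⟨ ℤₚ.+-monoˡ-≤ (ℤ.- τ V c) (τ-mono c<c′ c′≤J) ⟩
    τ V (cut (suc i)) ℤ.- τ V c                    ≡⟨ sym (at-π i i<I) ⟩
    at (π V) (suc i)                               ∎
    where
    open ℤₚ.≤-Reasoning
    i<I : i < I
    i<I = subst (suc i ≤_) lenJ-π i<lenJ
    c : ℕ
    c = cut i
    c′≤J : cut (suc i) ≤ lenJ V
    c′≤J = cut≤J (suc i) i<I
    c<c′ : c < cut (suc i)
    c<c′ = cut-strict i
    v≥2 : at V (suc c) ℤ.≥ + 2
    v≥2 = at-suc-cut≥2 v₁≥2 i (ℕₚ.≤-trans c<c′ c′≤J)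
    identity : ∀ x v → v ℤ.- + 1 ≡ x ℤ.+ (v ℤ.- + 1) ℤ.- x
    identity = ℤ-Ring.solve-∀

  at-π-last≥0 : at (π V) (suc (lenJ (π V))) ℤ.≥ + 0
  at-π-last≥0 rewrite lenJ-π = begin
    + 0
      ≤⟨ ℤₚ.+-mono-≤ (ℤₚ.i≤j⇒0≤j-i τcI≤τJ) last≥0 ⟩
    τ V (lenJ V) ℤ.- τ V (cut I) ℤ.+ at V (suc (lenJ V))
      ≡⟨ identity (τ V (lenJ V)) (τ V (cut I)) (at V (suc (lenJ V))) ⟩
    τ V (suc (lenJ V)) ℤ.- τ V (cut I) ℤ.+ + 1
      ≡⟨ cong (λ p → τ V p ℤ.- τ V (cut I) ℤ.+ + 1) (sym cut-last) ⟩
    τ V (cut (suc I)) ℤ.- τ V (cut I) ℤ.+ + 1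
      ≡⟨ sym at-π-last ⟩
    at (π V) (suc I) ∎
    where
    open ℤₚ.≤-Reasoning
    τcI≤τJ : τ V (cut I) ℤ.≤ τ V (lenJ V)
    τcI≤τJ = τ-mono (cut≤J I ℕₚ.≤-refl) ℕₚ.≤-refl
    identity : ∀ x y v → x ℤ.- y ℤ.+ v ≡ x ℤ.+ (v ℤ.- + 1) ℤ.- y ℤ.+ + 1
    identity = ℤ-Ring.solve-∀

  π∈M : InM (π V)
  π∈M = subst Odd (sym lenJ-π) (¬isEven⇒odd I I-odd) , subst (1 ≤_) (sym length-π) (s≤s z≤n)
      , at-π≥1 , at-π-last≥0

  ρ-π : ∀ i → i ≤ I → ρ (π V) i ≡ ρ V (cut i) ℤ.- indicator (not (isEven i))
  ρ-π zero    _     = refl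
  ρ-π (suc i) i+1≤I = begin
    addOrSub (isEven i) (ρ (π V) i) (at (π V) (suc i))
      ≡⟨ cong₂ (addOrSub (isEven i)) (ρ-π i (ℕₚ.<⇒≤ i+1≤I)) (at-π i i+1≤I) ⟩
    addOrSub (isEven i) (ρ V (cut i) ℤ.- indicator (not (isEven i))) (τ V (cut (suc i)) ℤ.- τ V (cut i))
      ≡⟨ addOrSub-shift (isEven i) (ρ V (cut i)) (τ V (cut (suc i)) ℤ.- τ V (cut i)) ⟩
    addOrSub (isEven i) (ρ V (cut i)) (span (cut i) (cut (suc i))) ℤ.- indicator (isEven i)
      ≡⟨ cong₂ ℤ._-_ (sym (ρ-cut i))
           (cong indicator (trans (sym (not-involutive (isEven i))) (cong not (sym (isEven-suc i))))) ⟩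
    ρ V (cut (suc i)) ℤ.- indicator (not (isEven (suc i))) ∎
    where open ≡-Reasoning

module _ (V : List ℤ) (v≥1 : ∀ i → 1 ≤ i → i ≤ lenJ V → at V i ℤ.≥ + 1)
         (odd-J : Odd (lenJ V)) (last≥0 : at V (suc (lenJ V)) ℤ.≥ + 0)
         {q t : ℕ} (odd-t : Odd t) (1≤t : 1 ≤ t) (t≤J : t ≤ lenJ V)
         (ρ>0 : ∀ i → 1 ≤ i → i ≤ t → ρ V i ℤ.> + 0) (ρt≥q+2 : ρ V t ℤ.≥ + suc (suc q)) where

  open Cuts V
  open PositiveEntries V v≥1

  v₁≥2 : at V 1 ℤ.≥ + 2
  v₁≥2 with ℕₚ.m≤n⇒m<n∨m≡n 1≤t
  ... | inj₂ 1≡t = begin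
    + 2             ≤⟨ +≤+ (s≤s (s≤s z≤n)) ⟩
    + suc (suc q)   ≤⟨ subst (λ s → ρ V s ℤ.≥ + suc (suc q)) (sym 1≡t) ρt≥q+2 ⟩
    ρ V 1           ≡⟨ ℤₚ.+-identityˡ (at V 1) ⟩
    at V 1          ∎
    where open ℤₚ.≤-Reasoning
  ... | inj₁ 1<t = begin
    + 2                  ≤⟨ ℤₚ.+-monoˡ-≤ (+ 1) (v≥1 2 (s≤s z≤n) (ℕₚ.≤-trans 1<t t≤J)) ⟩
    at V 2 ℤ.+ + 1       ≤⟨ ℤₚ.+-monoʳ-≤ (at V 2) (ℤₚ.i<j⇒suc[i]≤j (ρ>0 2 (s≤s z≤n) 1<t)) ⟩
    at V 2 ℤ.+ ρ V 2     ≡⟨ identity (at V 1) (at V 2) ⟩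
    at V 1               ∎
    where
    open ℤₚ.≤-Reasoning
    identity : ∀ v₁ v₂ → v₂ ℤ.+ (+ 0 ℤ.+ v₁ ℤ.- v₂) ≡ v₁
    identity = ℤ-Ring.solve-∀

  open ContractionShape V v≥1 odd-J last≥0 v₁≥2

  segment≤I : ∀ {j} → cut j < t → j ≤ I
  segment≤I cut<t = ℕₚ.≤-pred (cut-cancel-< (ℕₚ.<-≤-trans cut<t
    (ℕₚ.≤-trans t≤J (subst (lenJ V ≤_) (sym cut-last) (ℕₚ.n≤1+n (lenJ V))))))

  ρ-π>0 : ∀ i → 1 ≤ i → i ≤ I → cut i < t → ρ (π V) i ℤ.> + 0
  ρ-π>0 i 1≤i i≤I c<t = subst (+ 0 ℤ.<_) (sym (ρ-π i i≤I)) (positive (isEven i) refl)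
    where
    c : ℕ
    c = cut i
    positive : ∀ b → isEven i ≡ b → + 0 ℤ.< ρ V c ℤ.- indicator (not b)
    positive true  _     = subst (+ 0 ℤ.<_) (sym (ℤₚ.+-identityʳ (ρ V c)))
                             (ρ>0 c (ℕₚ.≤-trans 1≤i (≤-cut i)) (ℕₚ.<⇒≤ c<t))
    positive false i-odd = begin-strict
      + 0
        <⟨ ρ>0 (suc c) (s≤s z≤n) c<t ⟩
      ρ V (suc c)
        ≡⟨ cong (λ b → addOrSub b (ρ V c) (at V (suc c))) (trans (isEven-cut i) i-odd) ⟩
      ρ V c ℤ.- at V (suc c)
        ≤⟨ ℤₚ.+-monoʳ-≤ (ρ V c) (ℤₚ.neg-mono-≤ (v≥1 (suc c) (s≤s z≤n) (ℕₚ.≤-trans c<t t≤J))) ⟩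
      ρ V c ℤ.- + 1 ∎
      where open ℤₚ.≤-Reasoning

  Witness : Set
  Witness = ∃[ s ] (Odd s × 1 ≤ s × s ≤ I × (∀ i → i < s → cut i < t)
                    × ρ V t ℤ.- + 1 ℤ.≤ ρ (π V) s)

  witness⇒π∈M⁺ : Witness → InM⁺ q (π V)
  witness⇒π∈M⁺ (s , odd-s , 1≤s , s≤I , early , ρt-1≤) =
    π∈M , s , odd-s , 1≤s , subst (s ≤_) (sym lenJ-π) s≤I , positive , big
    where
    big : ρ (π V) s ℤ.≥ + suc q
    big = ℤₚ.≤-trans (ℤₚ.+-monoˡ-≤ (ℤ.- + 1) ρt≥q+2) ρt-1≤
    positive : ∀ i → 1 ≤ i → i ≤ s → ρ (π V) i ℤ.> + 0
    positive i 1≤i i≤s with ℕₚ.m≤n⇒m<n∨m≡n i≤s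
    ... | inj₁ i<s  = ρ-π>0 i 1≤i (ℕₚ.≤-trans (ℕₚ.<⇒≤ i<s) s≤I) (early i i<s)
    ... | inj₂ refl = ℤₚ.<-≤-trans (+<+ (s≤s z≤n)) big

  -- t at an odd offset from an even cut: the next cut, with odd index j + 1, reaches at least ρ t.
  witness-odd-offset : ∀ j i → (∀ k → k ≤ j → cut k < t) → t ≤ cut (suc j) →
                       t ≡ suc (cut j + 2 * i) → i ≤ run (cut j) → Witness
  witness-odd-offset j i below t≤next t≡ i≤m =
    suc j , ¬isEven⇒odd (suc j) j+1-odd , s≤s z≤n , j<I
          , (λ k k<j+1 → below k (ℕₚ.≤-pred k<j+1)) , bound
    where
    r : ℕ
    r = cut j
    r-even : isEven r ≡ true
    r-even = not-injective (trans (sym (trans (cong isEven t≡)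
               (trans (isEven-suc (r + 2 * i)) (cong not (isEven-+-2* r i))))) (odd⇒¬isEven t odd-t))
    j-even : isEven j ≡ true
    j-even = trans (sym (isEven-cut j)) r-even
    j+1-odd : isEven (suc j) ≡ false
    j+1-odd = trans (isEven-suc j) (cong not j-even)
    j<I : suc j ≤ I
    j<I = ℕₚ.≤∧≢⇒< (segment≤I (below j ℕₚ.≤-refl))
            (λ j≡I → not-¬ (trans (sym (cong isEven j≡I)) j-even) I-odd)
    ρt≡ : ρ V t ≡ ρ V r ℤ.+ span r t
    ρt≡ = trans (cong (ρ V) t≡) (trans (ρ-run r i (OnesAfter-≤ {r} i≤m (run-ones r)))
            (cong₂ (λ b p → addOrSub b (ρ V r) (span r p)) r-even (sym t≡)))
    ρnext≡ : ρ V (cut (suc j)) ≡ ρ V r ℤ.+ span r (cut (suc j))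
    ρnext≡ = trans (ρ-cut j) (cong (λ b → addOrSub b (ρ V r) (span r (cut (suc j)))) j-even)
    bound : ρ V t ℤ.- + 1 ℤ.≤ ρ (π V) (suc j)
    bound = begin
      ρ V t ℤ.- + 1
        ≡⟨ cong (ℤ._- + 1) ρt≡ ⟩
      ρ V r ℤ.+ span r t ℤ.- + 1
        ≤⟨ ℤₚ.+-monoˡ-≤ (ℤ.- + 1) (ℤₚ.+-monoʳ-≤ (ρ V r) (span-mono r t≤next (cut≤J (suc j) j<I))) ⟩
      ρ V r ℤ.+ span r (cut (suc j)) ℤ.- + 1
        ≡⟨ cong (ℤ._- + 1) (sym ρnext≡) ⟩
      ρ V (cut (suc j)) ℤ.- + 1
        ≡⟨ cong (λ b → ρ V (cut (suc j)) ℤ.- indicator (not b)) (sym j+1-odd) ⟩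
      ρ V (cut (suc j)) ℤ.- indicator (not (isEven (suc j)))
        ≡⟨ sym (ρ-π (suc j) j<I) ⟩
      ρ (π V) (suc j) ∎
      where open ℤₚ.≤-Reasoning

  -- t at an even offset from an odd cut: ρ has dropped by a positive span since that cut j.
  witness-even-offset : ∀ j i → (∀ k → k ≤ j → cut k < t) →
                        t ≡ suc (suc (cut j + 2 * i)) → i < run (cut j) → Witness
  witness-even-offset j i below t≡ i<m =
    j , ¬isEven⇒odd j j-odd , 1≤j , j≤I , (λ k k<j → below k (ℕₚ.<⇒≤ k<j)) , bound
    where
    r a : ℕ
    r = cut j
    a = r + 2 * i
    j≤I : j ≤ I
    j≤I = segment≤I (below j ℕₚ.≤-refl)
    r-odd : isEven r ≡ false
    r-odd = trans (sym (trans (cong isEven t≡) (trans (isEven-2+ a) (isEven-+-2* r i))))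
                  (odd⇒¬isEven t odd-t)
    j-odd : isEven j ≡ false
    j-odd = trans (sym (isEven-cut j)) r-odd
    1≤j : 1 ≤ j
    1≤j = ℕₚ.n≢0⇒n>0 (λ j≡0 → not-¬ (cong isEven j≡0) j-odd)
    a+1≤J : suc a ≤ lenJ V
    a+1≤J = ℕₚ.≤-trans (ℕₚ.n≤1+n (suc a)) (subst (_≤ lenJ V) t≡ t≤J)
    1≤span : + 1 ℤ.≤ span r (suc a)
    1≤span = ℤₚ.≤-trans (v≥1 (suc r) (s≤s z≤n) (ℕₚ.≤-trans (s≤s (ℕₚ.m≤m+n r (2 * i))) a+1≤J))
                        (at-suc≤span (s≤s (ℕₚ.m≤m+n r (2 * i))) a+1≤J)
    identity : ∀ x → x ℤ.+ + 1 ℤ.- + 1 ≡ x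
    identity = ℤ-Ring.solve-∀
    ρt-1≡ : ρ V t ℤ.- + 1 ≡ ρ V r ℤ.- span r (suc a)
    ρt-1≡ = begin
      ρ V t ℤ.- + 1
        ≡⟨ cong (λ p → ρ V p ℤ.- + 1) t≡ ⟩
      addOrSub (isEven (suc a)) (ρ V (suc a)) (at V (suc (suc a))) ℤ.- + 1
        ≡⟨ cong₂ (λ b v → addOrSub b (ρ V (suc a)) v ℤ.- + 1)
             (trans (isEven-suc a) (cong not (trans (isEven-+-2* r i) r-odd))) (run-ones r i i<m) ⟩
      ρ V (suc a) ℤ.+ + 1 ℤ.- + 1
        ≡⟨ identity (ρ V (suc a)) ⟩
      ρ V (suc a)
        ≡⟨ ρ-run r i (OnesAfter-≤ {r} (ℕₚ.<⇒≤ i<m) (run-ones r)) ⟩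
      addOrSub (isEven r) (ρ V r) (span r (suc a))
        ≡⟨ cong (λ b → addOrSub b (ρ V r) (span r (suc a))) r-odd ⟩
      ρ V r ℤ.- span r (suc a) ∎
      where open ≡-Reasoning
    bound : ρ V t ℤ.- + 1 ℤ.≤ ρ (π V) j
    bound = begin
      ρ V t ℤ.- + 1                          ≡⟨ ρt-1≡ ⟩
      ρ V r ℤ.- span r (suc a)               ≤⟨ ℤₚ.+-monoʳ-≤ (ρ V r) (ℤₚ.neg-mono-≤ 1≤span) ⟩
      ρ V r ℤ.- + 1                          ≡⟨ cong (λ b → ρ V r ℤ.- indicator (not b)) (sym j-odd) ⟩
      ρ V r ℤ.- indicator (not (isEven j))   ≡⟨ sym (ρ-π j j≤I) ⟩
      ρ (π V) j                              ∎
      where open ℤₚ.≤-Reasoning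

  π∈M⁺ : InM⁺ q (π V)
  π∈M⁺ with crossing cut cut-strict 1≤t
  ... | j , below , t≤next with position-in-run (below j ℕₚ.≤-refl) (subst (t ≤_) (cut-suc j) t≤next)
  ...   | inj₁ (i , i≤m , t≡) = witness⇒π∈M⁺ (witness-odd-offset j i below t≤next t≡ i≤m)
  ...   | inj₂ (i , i<m , t≡) = witness⇒π∈M⁺ (witness-even-offset j i below t≡ i<m)

mainTheorem6 : (p : ℕ) → 0 < p → (V : List ℤ) → InM⁺ p V → InM⁺ (p ∸ 1) (π V)
mainTheorem6 (suc q) _ V ((odd-J , _ , v≥1 , last≥0) , t , odd-t , 1≤t , t≤J , ρ>0 , ρt≥q+2) =
  π∈M⁺ V v≥1 odd-J last≥0 odd-t 1≤t t≤J ρ>0 ρt≥q+2
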